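{- Let $0 \leq m \leq n$ be integers and let $f$ and $g$ be real-valued functions on $Q_m$. Then $f$ and $g$ are isomorphic when thought of as functions on $Q_m$ if and only if they are isomorphic when thought of as functions on $Q_n$.
   Context: $Q_n$ is the $n$-dimensional Boolean hypercube with vertex set $\{ -1,1\}^n$, two vertices being adjacent iff they differ in exactly one coordinate. A real-valued function $f$ on $Q_m$ is thought of as a function on $Q_n$ ($n\ge m$) via $x\mapsto f(x_1,\dots,x_m)$, i.e. the coordinates $m<i\le n$ are irrelevant (the value does not depend on them). Two real-valued functions $f,g$ on $Q_N$ are isomorphic if there is a graph automorphism $\phi$ of $Q_N$ and a sign $\epsilon\in\{ -1,1\}$ with $f=\epsilon\, g\circ\phi$. -}

module Defs where

open import Level using (Level)
open import Data.Bool using (Bool; true; false; _≟_)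
open import Data.Nat using (ℕ; zero; suc; _+_)
open import Data.Vec using (Vec; []; _∷_; take)
open import Data.Product using (Σ; _×_; _,_)
open import Relation.Binary.PropositionalEquality using (_≡_)
open import Relation.Nullary using (yes; no)
open import Algebra.Bundles using (AbelianGroup)

-- Vertices of Q_n : {-1,1}^n, encoded as Vec Bool n (true = 1, false = -1).
Vertex : ℕ → Set
Vertex n = Vec Bool n

dist : ∀ {n} → Vertex n → Vertex n → ℕ
dist [] [] = 0
dist (a ∷ x) (b ∷ y) with a ≟ b
... | yes _ = dist x y
... | no _  = suc (dist x y)

Adj : ∀ {n} → Vertex n → Vertex n → Set
Adj x y = dist x y ≡ 1

record Automorphism (n : ℕ) : Set where
  field
    to       : Vertex n → Vertex n
    from     : Vertex n → Vertex n
    to-from  : ∀ x → to (from x) ≡ x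
    from-to  : ∀ x → from (to x) ≡ x
    adj-to   : ∀ x y → Adj x y → Adj (to x) (to y)
    adj-from : ∀ x y → Adj (to x) (to y) → Adj x y

module _ {c ℓ : Level} (G : AbelianGroup c ℓ) where
  open AbelianGroup G renaming (Carrier to V)

  -- The sign ε ∈ {-1,1} acting on values (true = +1, false = -1).
  signed : Bool → V → V
  signed true  v = v
  signed false v = v ⁻¹

  Isomorphic : (N : ℕ) → (Vertex N → V) → (Vertex N → V) → Set ℓ
  Isomorphic N f g =
    Σ (Automorphism N) λ φ → Σ Bool λ ε →
      ∀ x → f x ≈ signed ε (g (Automorphism.to φ x))

  lift : (m k : ℕ) → (Vertex m → V) → Vertex (m + k) → V
  lift m k f x = f (take m x)

-- An automorphism of the cube maps the two opposite edges of every square to opposite edges, so by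
-- connectedness it maps all edges in a direction d to edges in a single direction j.
-- Lifting an isomorphism is easy: extend the automorphism of Q_m by the identity on the new coordinates.
-- Conversely, the irrelevant coordinates are removed one at a time. If F₁ = ε F₂ ∘ ψ and both are
-- invariant in direction d, then F₂ is invariant in the direction j that ψ sends d to; composing ψ
-- with the transposition of the coordinates j and d leaves F₂ unchanged and yields an automorphism
-- commuting with the flip in direction d, which therefore descends to the cube without coordinate d.
module Submission where

open import Level using (Level)
open import Algebra.Bundles using (AbelianGroup)
open import Data.Bool using (Bool; true; false; not) renaming (_≟_ to _≟ᵇ_)
open import Data.Bool.Properties using (not-involutive; not-¬; ¬-not)
open import Data.Empty using (⊥-elim)
open import Data.Fin using (Fin; zero; suc; _↑ʳ_; _≟_)
open import Data.Fin.Permutation using (Permutation′; _⟨$⟩ʳ_; _⟨$⟩ˡ_; inverseˡ; inverseʳ; flip; transpose)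
import Data.Fin.Permutation.Components as PC
open import Data.Nat using (ℕ; zero; suc; _+_)
open import Data.Nat.Properties using (suc-injective; +-commutativeSemigroup)
open import Algebra.Properties.CommutativeSemigroup +-commutativeSemigroup using (x∙yz≈y∙xz)
open import Data.Product as Prod using (∃; Σ; _×_; _,_; proj₁; proj₂)
open import Data.Sum as Sum using (_⊎_; inj₁; inj₂)
open import Data.Vec using ([]; _∷_; head; tail; _++_; lookup; take; drop; tabulate; updateAt; replicate)
open import Data.Vec.Properties
  using (lookup∘updateAt; lookup∘updateAt′; updateAt-commutes; lookup∘tabulate; tabulate∘lookup;
         tabulate-cong; take++drop≡id; ++-injectiveˡ; ++-injectiveʳ)
open import Function.Base using (_∘′_)
open import Function.Bundles using (_⇔_; mk⇔)
open import Relation.Binary.PropositionalEquality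
  using (_≡_; _≢_; refl; sym; trans; cong; cong₂; subst; subst₂; ≢-sym; module ≡-Reasoning)
open import Relation.Nullary using (yes; no)

open import Defs

private
  variable
    m n k : ℕ

-- The cube and its distance

m+n≡1⇒ : ∀ m {n} → m + n ≡ 1 → (m ≡ 1 × n ≡ 0) ⊎ (m ≡ 0 × n ≡ 1)
m+n≡1⇒ zero          eq = inj₂ (refl , eq)
m+n≡1⇒ (suc zero)    eq = inj₁ (refl , suc-injective eq)
m+n≡1⇒ (suc (suc m)) ()

flipAt : Fin n → Vertex n → Vertex n
flipAt i x = updateAt x i not

lookup-flipAt : ∀ (i : Fin n) x → lookup (flipAt i x) i ≡ not (lookup x i)
lookup-flipAt i x = lookup∘updateAt i x

lookup-flipAt′ : ∀ {i j : Fin n} → j ≢ i → ∀ x → lookup (flipAt i x) j ≡ lookup x j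
lookup-flipAt′ j≢i x = lookup∘updateAt′ _ _ j≢i x

flipAt-involutive : ∀ (i : Fin n) x → flipAt i (flipAt i x) ≡ x
flipAt-involutive zero    (a ∷ x) = cong (_∷ x) (not-involutive a)
flipAt-involutive (suc i) (a ∷ x) = cong (a ∷_) (flipAt-involutive i x)

flipAt-comm : ∀ (i j : Fin n) x → flipAt i (flipAt j x) ≡ flipAt j (flipAt i x)
flipAt-comm i j x with i ≟ j
... | yes refl = refl
... | no i≢j   = updateAt-commutes i j i≢j x

flipAt-injectiveˡ : ∀ {i j : Fin n} x → flipAt i x ≡ flipAt j x → i ≡ j
flipAt-injectiveˡ {i = i} {j} x eq with i ≟ j
... | yes i≡j = i≡j
... | no i≢j  = ⊥-elim (not-¬ refl (begin
  lookup x i              ≡⟨ lookup-flipAt′ i≢j x ⟨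
  lookup (flipAt j x) i   ≡⟨ cong (λ y → lookup y i) eq ⟨
  lookup (flipAt i x) i   ≡⟨ lookup-flipAt i x ⟩
  not (lookup x i)        ∎))
  where open ≡-Reasoning

lookup-ext : ∀ {x y : Vertex n} → (∀ p → lookup x p ≡ lookup y p) → x ≡ y
lookup-ext {x = x} {y} eq =
  trans (sym (tabulate∘lookup x)) (trans (tabulate-cong eq) (tabulate∘lookup y))

dist-∷ : ∀ a b (x y : Vertex n) → dist (a ∷ x) (b ∷ y) ≡ dist (a ∷ []) (b ∷ []) + dist x y
dist-∷ true  true  x y = refl
dist-∷ true  false x y = refl
dist-∷ false true  x y = refl
dist-∷ false false x y = refl

dist-self : ∀ (x : Vertex n) → dist x x ≡ 0
dist-self []          = refl
dist-self (true ∷ x)  = dist-self x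
dist-self (false ∷ x) = dist-self x

dist≡0⇒≡ : ∀ {x y : Vertex n} → dist x y ≡ 0 → x ≡ y
dist≡0⇒≡ {x = []}        {[]}        _  = refl
dist≡0⇒≡ {x = true ∷ x}  {true ∷ y}  eq = cong (true ∷_) (dist≡0⇒≡ eq)
dist≡0⇒≡ {x = false ∷ x} {false ∷ y} eq = cong (false ∷_) (dist≡0⇒≡ eq)
dist≡0⇒≡ {x = true ∷ x}  {false ∷ y} ()
dist≡0⇒≡ {x = false ∷ x} {true ∷ y}  ()

adj-flipAt : ∀ (i : Fin n) x → Adj x (flipAt i x)
adj-flipAt zero    (true ∷ x)  = cong suc (dist-self x)
adj-flipAt zero    (false ∷ x) = cong suc (dist-self x)
adj-flipAt (suc i) (true ∷ x)  = adj-flipAt i x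
adj-flipAt (suc i) (false ∷ x) = adj-flipAt i x

adj⇒flipAt : ∀ {x y : Vertex n} → Adj x y → ∃ λ i → y ≡ flipAt i x
adj⇒flipAt {x = []}       {[]}        ()
adj⇒flipAt {x = true ∷ x}  {true ∷ y}  eq = Prod.map suc (cong (true ∷_)) (adj⇒flipAt eq)
adj⇒flipAt {x = false ∷ x} {false ∷ y} eq = Prod.map suc (cong (false ∷_)) (adj⇒flipAt eq)
adj⇒flipAt {x = true ∷ x}  {false ∷ y} eq = zero , cong (false ∷_) (sym (dist≡0⇒≡ (suc-injective eq)))
adj⇒flipAt {x = false ∷ x} {true ∷ y}  eq = zero , cong (true ∷_) (sym (dist≡0⇒≡ (suc-injective eq)))

cube-connected : (P : Vertex n → Set) → (∀ i x → P x → P (flipAt i x)) → ∀ x y → P x → P y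
cube-connected P closed []       []       px = px
cube-connected P closed (a ∷ x) (b ∷ y) px =
  last-step a b (cube-connected (λ z → P (a ∷ z)) (λ i z → closed (suc i) (a ∷ z)) x y px)
  where
  last-step : ∀ a b → P (a ∷ y) → P (b ∷ y)
  last-step true  true  p = p
  last-step false false p = p
  last-step true  false p = closed zero _ p
  last-step false true  p = closed zero _ p

dist-++ : ∀ (xs xs′ : Vertex m) (ys ys′ : Vertex n) →
          dist (xs ++ ys) (xs′ ++ ys′) ≡ dist xs xs′ + dist ys ys′
dist-++ []          []           ys ys′ = refl
dist-++ (true ∷ xs)  (true ∷ xs′)  ys ys′ = dist-++ xs xs′ ys ys′
dist-++ (false ∷ xs) (false ∷ xs′) ys ys′ = dist-++ xs xs′ ys ys′
dist-++ (true ∷ xs)  (false ∷ xs′) ys ys′ = cong suc (dist-++ xs xs′ ys ys′)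
dist-++ (false ∷ xs) (true ∷ xs′)  ys ys′ = cong suc (dist-++ xs xs′ ys ys′)

adj-++⁻ : ∀ {xs xs′ : Vertex m} {ys ys′ : Vertex n} → Adj (xs ++ ys) (xs′ ++ ys′) →
          (Adj xs xs′ × ys ≡ ys′) ⊎ (xs ≡ xs′ × Adj ys ys′)
adj-++⁻ {xs = xs} {xs′} {ys} {ys′} adj =
  Sum.map (Prod.map₂ dist≡0⇒≡) (Prod.map₁ dist≡0⇒≡)
          (m+n≡1⇒ (dist xs xs′) (trans (sym (dist-++ xs xs′ ys ys′)) adj))

adj-++⁺ : ∀ {xs xs′ : Vertex m} {ys ys′ : Vertex n} →
          (Adj xs xs′ × ys ≡ ys′) ⊎ (xs ≡ xs′ × Adj ys ys′) → Adj (xs ++ ys) (xs′ ++ ys′)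
adj-++⁺ {xs = xs} {xs′} {ys} (inj₁ (adj , refl)) =
  trans (dist-++ xs xs′ ys ys) (cong₂ _+_ adj (dist-self ys))
adj-++⁺ {xs = xs} {ys = ys} {ys′} (inj₂ (refl , adj)) =
  trans (dist-++ xs xs ys ys′) (cong₂ _+_ (dist-self xs) adj)

take-++ : ∀ (xs : Vertex m) (ys : Vertex n) → take m (xs ++ ys) ≡ xs
take-++ {m} xs ys = ++-injectiveˡ _ xs (take++drop≡id m (xs ++ ys))

drop-++ : ∀ (xs : Vertex m) (ys : Vertex n) → drop m (xs ++ ys) ≡ ys
drop-++ {m} xs ys = ++-injectiveʳ _ xs (take++drop≡id m (xs ++ ys))

take++[] : ∀ m (x : Vertex (m + 0)) → take m x ++ [] ≡ x
take++[] m x with drop m x | take++drop≡id m x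
... | [] | eq = eq

dist-take : ∀ m (x y : Vertex (m + 0)) → dist (take m x) (take m y) ≡ dist x y
dist-take zero    []      []      = refl
dist-take (suc m) (a ∷ x) (b ∷ y) = begin
  dist (a ∷ take m x) (b ∷ take m y)                  ≡⟨ dist-∷ a b _ _ ⟩
  dist (a ∷ []) (b ∷ []) + dist (take m x) (take m y) ≡⟨ cong (_ +_) (dist-take m x y) ⟩
  dist (a ∷ []) (b ∷ []) + dist x y                   ≡⟨ dist-∷ a b x y ⟨
  dist (a ∷ x) (b ∷ y)                                ∎
  where open ≡-Reasoning

-- Coordinate m of Vertex (m + suc k), of index m ↑ʳ zero, is the first one that lift ignores.
insertMid : ∀ m → Bool → Vertex (m + k) → Vertex (m + suc k)
insertMid zero    b v       = b ∷ v
insertMid (suc m) b (a ∷ v) = a ∷ insertMid m b v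

removeMid : ∀ m → Vertex (m + suc k) → Vertex (m + k)
removeMid zero    (b ∷ v) = v
removeMid (suc m) (a ∷ w) = a ∷ removeMid m w

removeMid-insertMid : ∀ m b (v : Vertex (m + k)) → removeMid m (insertMid m b v) ≡ v
removeMid-insertMid zero    b v       = refl
removeMid-insertMid (suc m) b (a ∷ v) = cong (a ∷_) (removeMid-insertMid m b v)

removeMid-flipAt : ∀ m (w : Vertex (m + suc k)) → removeMid m (flipAt (m ↑ʳ zero) w) ≡ removeMid m w
removeMid-flipAt zero    (b ∷ v) = refl
removeMid-flipAt (suc m) (a ∷ w) = cong (a ∷_) (removeMid-flipAt m w)

removeMid-fibre : ∀ m {w w′ : Vertex (m + suc k)} → removeMid m w ≡ removeMid m w′ →
                  w′ ≡ w ⊎ w′ ≡ flipAt (m ↑ʳ zero) w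
removeMid-fibre zero {true ∷ v}  {true ∷ v′}  refl = inj₁ refl
removeMid-fibre zero {false ∷ v} {false ∷ v′} refl = inj₁ refl
removeMid-fibre zero {true ∷ v}  {false ∷ v′} refl = inj₂ refl
removeMid-fibre zero {false ∷ v} {true ∷ v′}  refl = inj₂ refl
removeMid-fibre (suc m) {a ∷ w} {a′ ∷ w′} eq with refl ← cong head eq =
  Sum.map (cong (a ∷_)) (cong (a ∷_)) (removeMid-fibre m (cong tail eq))

dist-removeMid : ∀ m (w w′ : Vertex (m + suc k)) →
  dist w w′ ≡ dist (lookup w (m ↑ʳ zero) ∷ []) (lookup w′ (m ↑ʳ zero) ∷ []) + dist (removeMid m w) (removeMid m w′)
dist-removeMid zero    (b ∷ v) (b′ ∷ v′) = dist-∷ b b′ v v′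
dist-removeMid (suc m) (a ∷ w) (a′ ∷ w′) = begin
  dist (a ∷ w) (a′ ∷ w′)               ≡⟨ dist-∷ a a′ w w′ ⟩
  dist (a ∷ []) (a′ ∷ []) + dist w w′  ≡⟨ cong (_ +_) (dist-removeMid m w w′) ⟩
  A + (B + D)                          ≡⟨ x∙yz≈y∙xz A B D ⟩
  B + (A + D)                          ≡⟨ cong (B +_) (dist-∷ a a′ (removeMid m w) (removeMid m w′)) ⟨
  B + dist (a ∷ removeMid m w) (a′ ∷ removeMid m w′) ∎
  where
  open ≡-Reasoning
  A = dist (a ∷ []) (a′ ∷ [])
  B = dist (lookup w (m ↑ʳ zero) ∷ []) (lookup w′ (m ↑ʳ zero) ∷ [])
  D = dist (removeMid m w) (removeMid m w′)

adj-removeMid : ∀ m {w w′ : Vertex (m + suc k)} → Adj w w′ →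
                Adj (removeMid m w) (removeMid m w′) ⊎ w′ ≡ flipAt (m ↑ʳ zero) w
adj-removeMid m {w} {w′} adj with m+n≡1⇒ _ (trans (sym (dist-removeMid m w w′)) adj)
... | inj₂ (_ , adj′) = inj₁ adj′
... | inj₁ (_ , d≡0) with removeMid-fibre m (dist≡0⇒≡ d≡0)
...   | inj₂ w′≡flip = inj₂ w′≡flip
...   | inj₁ refl    with () ← trans (sym (dist-self w)) adj

dist-insertMid : ∀ m b (v v′ : Vertex (m + k)) → dist (insertMid m b v) (insertMid m b v′) ≡ dist v v′
dist-insertMid zero    true  v v′ = refl
dist-insertMid zero    false v v′ = refl
dist-insertMid (suc m) b (true ∷ v)  (true ∷ v′)  = dist-insertMid m b v v′
dist-insertMid (suc m) b (false ∷ v) (false ∷ v′) = dist-insertMid m b v v′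
dist-insertMid (suc m) b (true ∷ v)  (false ∷ v′) = cong suc (dist-insertMid m b v v′)
dist-insertMid (suc m) b (false ∷ v) (true ∷ v′)  = cong suc (dist-insertMid m b v v′)

lookup-insertMid : ∀ m b (v : Vertex (m + k)) → lookup (insertMid m b v) (m ↑ʳ zero) ≡ b
lookup-insertMid zero    b v       = refl
lookup-insertMid (suc m) b (a ∷ v) = lookup-insertMid m b v

insertMid≢flipAt : ∀ m {b} {v v′ : Vertex (m + k)} → insertMid m b v′ ≢ flipAt (m ↑ʳ zero) (insertMid m b v)
insertMid≢flipAt m {b} {v} {v′} eq = not-¬ refl (begin
  b                                                         ≡⟨ lookup-insertMid m b v′ ⟨
  lookup (insertMid m b v′) (m ↑ʳ zero)                     ≡⟨ cong (λ w → lookup w (m ↑ʳ zero)) eq ⟩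
  lookup (flipAt (m ↑ʳ zero) (insertMid m b v)) (m ↑ʳ zero) ≡⟨ lookup-flipAt (m ↑ʳ zero) (insertMid m b v) ⟩
  not (lookup (insertMid m b v) (m ↑ʳ zero))                ≡⟨ cong not (lookup-insertMid m b v) ⟩
  not b                                                     ∎)
  where open ≡-Reasoning

insertMid-removeMid : ∀ m b (w : Vertex (m + suc k)) →
  insertMid m b (removeMid m w) ≡ w ⊎ insertMid m b (removeMid m w) ≡ flipAt (m ↑ʳ zero) w
insertMid-removeMid m b w = removeMid-fibre m (sym (removeMid-insertMid m b (removeMid m w)))

take-insertMid : ∀ m b (v : Vertex (m + k)) → take m (insertMid m b v) ≡ take m v
take-insertMid zero    b v       = refl
take-insertMid (suc m) b (a ∷ v) = cong (a ∷_) (take-insertMid m b v)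

take-flipAt-mid : ∀ m (w : Vertex (m + suc k)) → take m (flipAt (m ↑ʳ zero) w) ≡ take m w
take-flipAt-mid zero    (b ∷ v) = refl
take-flipAt-mid (suc m) (a ∷ w) = cong (a ∷_) (take-flipAt-mid m w)

-- Automorphisms permute the directions

automorphism : (f g : Vertex n → Vertex n) → (∀ x → f (g x) ≡ x) → (∀ x → g (f x) ≡ x) →
               (∀ x y → Adj x y → Adj (f x) (f y)) → (∀ x y → Adj x y → Adj (g x) (g y)) →
               Automorphism n
automorphism f g f∘g g∘f f-adj g-adj = record
  { to       = f
  ; from     = g
  ; to-from  = f∘g
  ; from-to  = g∘f
  ; adj-to   = f-adj
  ; adj-from = λ x y adj → subst₂ Adj (g∘f x) (g∘f y) (g-adj (f x) (f y) adj)
  }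

flipAt-equivariant⇒adj : (f : Vertex n → Vertex n) → (∀ i x → ∃ λ j → f (flipAt i x) ≡ flipAt j (f x)) →
                         ∀ x y → Adj x y → Adj (f x) (f y)
flipAt-equivariant⇒adj f equivariant x y adj with i , refl ← adj⇒flipAt {x = x} {y} adj =
  let j , fx′≡ = equivariant i x in subst (Adj (f x)) (sym fx′≡) (adj-flipAt j (f x))

module _ (ψ : Automorphism n) where
  open Automorphism ψ

  to-injective : ∀ {x y} → to x ≡ to y → x ≡ y
  to-injective {x} {y} eq = trans (sym (from-to x)) (trans (cong from eq) (from-to y))

  from-adj : ∀ x y → Adj x y → Adj (from x) (from y)
  from-adj x y adj = adj-from _ _ (subst₂ Adj (sym (to-from x)) (sym (to-from y)) adj)

  inverse : Automorphism n
  inverse = automorphism from to from-to to-from from-adj adj-to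

  to-flipAt : ∀ i x → ∃ λ j → to (flipAt i x) ≡ flipAt j (to x)
  to-flipAt i x = adj⇒flipAt (adj-to x (flipAt i x) (adj-flipAt i x))

_∘ᴬ_ : Automorphism n → Automorphism n → Automorphism n
τ ∘ᴬ ψ = automorphism (T.to ∘′ P.to) (P.from ∘′ T.from)
  (λ x → trans (cong T.to (P.to-from _)) (T.to-from x))
  (λ x → trans (cong P.from (T.from-to _)) (P.from-to x))
  (λ x y adj → T.adj-to _ _ (P.adj-to x y adj))
  (λ x y adj → from-adj ψ _ _ (from-adj τ x y adj))
  where
  module T = Automorphism τ
  module P = Automorphism ψ

four-cycle : ∀ {a b c e : Fin n} u → flipAt c (flipAt a u) ≡ flipAt e (flipAt b u) →
             a ≢ b → c ≢ a → c ≡ b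
four-cycle {a = a} {b} {c} {e} u eq a≢b c≢a with c ≟ b | e ≟ a
... | yes c≡b | _        = c≡b
... | no c≢b  | yes refl = ⊥-elim (not-¬ refl (begin
  lookup u b                          ≡⟨ lookup-flipAt′ (≢-sym a≢b) u ⟨
  lookup (flipAt a u) b               ≡⟨ lookup-flipAt′ (≢-sym c≢b) (flipAt a u) ⟨
  lookup (flipAt c (flipAt a u)) b    ≡⟨ cong (λ v → lookup v b) eq ⟩
  lookup (flipAt a (flipAt b u)) b    ≡⟨ lookup-flipAt′ (≢-sym a≢b) (flipAt b u) ⟩
  lookup (flipAt b u) b               ≡⟨ lookup-flipAt b u ⟩
  not (lookup u b)                    ∎))
  where open ≡-Reasoning
... | no _    | no e≢a   = ⊥-elim (not-¬ refl (begin
  lookup u a                          ≡⟨ lookup-flipAt′ a≢b u ⟨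
  lookup (flipAt b u) a               ≡⟨ lookup-flipAt′ (≢-sym e≢a) (flipAt b u) ⟨
  lookup (flipAt e (flipAt b u)) a    ≡⟨ cong (λ v → lookup v a) eq ⟨
  lookup (flipAt c (flipAt a u)) a    ≡⟨ lookup-flipAt′ (≢-sym c≢a) (flipAt a u) ⟩
  lookup (flipAt a u) a               ≡⟨ lookup-flipAt a u ⟩
  not (lookup u a)                    ∎))
  where open ≡-Reasoning

flipAt-flipAt≡⇒≡ : ∀ {i j : Fin n} x → flipAt i (flipAt j x) ≡ x → j ≡ i
flipAt-flipAt≡⇒≡ {i = i} {j} x eq =
  flipAt-injectiveˡ x (trans (sym (flipAt-involutive i _)) (cong (flipAt i) eq))

module _ (ψ : Automorphism n) where
  open Automorphism ψ

  parallel-edge : ∀ {d j} l x → to (flipAt d x) ≡ flipAt j (to x) →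
                  to (flipAt d (flipAt l x)) ≡ flipAt j (to (flipAt l x))
  parallel-edge {d = d} {j} l x eq with l ≟ d
  ... | yes refl = begin
    to (flipAt l (flipAt l x))   ≡⟨ cong to (flipAt-involutive l x) ⟩
    to x                         ≡⟨ flipAt-involutive j (to x) ⟨
    flipAt j (flipAt j (to x))   ≡⟨ cong (flipAt j) eq ⟨
    flipAt j (to (flipAt l x))   ∎
    where open ≡-Reasoning
  ... | no l≢d = subst (λ c → to (flipAt d (flipAt l x)) ≡ flipAt c (to (flipAt l x)))
                       (four-cycle (to x) square p≢j c≢p) ec
    where
    p = proj₁ (to-flipAt ψ l x)
    ep = proj₂ (to-flipAt ψ l x)
    c = proj₁ (to-flipAt ψ d (flipAt l x))
    ec = proj₂ (to-flipAt ψ d (flipAt l x))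
    e = proj₁ (to-flipAt ψ l (flipAt d x))
    ee = proj₂ (to-flipAt ψ l (flipAt d x))
    open ≡-Reasoning
    square : flipAt c (flipAt p (to x)) ≡ flipAt e (flipAt j (to x))
    square = begin
      flipAt c (flipAt p (to x))     ≡⟨ cong (flipAt c) ep ⟨
      flipAt c (to (flipAt l x))     ≡⟨ ec ⟨
      to (flipAt d (flipAt l x))     ≡⟨ cong to (flipAt-comm d l x) ⟩
      to (flipAt l (flipAt d x))     ≡⟨ ee ⟩
      flipAt e (to (flipAt d x))     ≡⟨ cong (flipAt e) eq ⟩
      flipAt e (flipAt j (to x))     ∎
    p≢j : p ≢ j
    p≢j refl = l≢d (flipAt-injectiveˡ x (to-injective ψ (trans ep (sym eq))))
    c≢p : c ≢ p
    c≢p c≡p = l≢d (flipAt-flipAt≡⇒≡ x (to-injective ψ (begin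
      to (flipAt d (flipAt l x))     ≡⟨ ec ⟩
      flipAt c (to (flipAt l x))     ≡⟨ cong₂ flipAt c≡p ep ⟩
      flipAt p (flipAt p (to x))     ≡⟨ flipAt-involutive p (to x) ⟩
      to x                           ∎)))

  direction : ∀ d → ∃ λ j → ∀ x → to (flipAt d x) ≡ flipAt j (to x)
  direction d = j , λ x → cube-connected P parallel-edge x₀ x e₀
    where
    x₀ = replicate n false
    j = proj₁ (to-flipAt ψ d x₀)
    e₀ = proj₂ (to-flipAt ψ d x₀)
    P : Vertex n → Set
    P x = to (flipAt d x) ≡ flipAt j (to x)

-- Permuting coordinates

permute : Permutation′ n → Vertex n → Vertex n
permute π z = tabulate (λ p → lookup z (π ⟨$⟩ʳ p))

lookup-permute : ∀ (π : Permutation′ n) z p → lookup (permute π z) p ≡ lookup z (π ⟨$⟩ʳ p)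
lookup-permute π z = lookup∘tabulate (λ p → lookup z (π ⟨$⟩ʳ p))

permute-inverse : ∀ (π : Permutation′ n) z → permute π (permute (flip π) z) ≡ z
permute-inverse π z = lookup-ext λ p → begin
  lookup (permute π (permute (flip π) z)) p   ≡⟨ lookup-permute π (permute (flip π) z) p ⟩
  lookup (permute (flip π) z) (π ⟨$⟩ʳ p)      ≡⟨ lookup-permute (flip π) z _ ⟩
  lookup z (π ⟨$⟩ˡ (π ⟨$⟩ʳ p))                ≡⟨ cong (lookup z) (inverseˡ π) ⟩
  lookup z p                                  ∎
  where open ≡-Reasoning

permute-flipAt : ∀ (π : Permutation′ n) l z → permute π (flipAt l z) ≡ flipAt (π ⟨$⟩ˡ l) (permute π z)
permute-flipAt π l z = lookup-ext at
  where
  open ≡-Reasoning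
  at : ∀ p → lookup (permute π (flipAt l z)) p ≡ lookup (flipAt (π ⟨$⟩ˡ l) (permute π z)) p
  at p with p ≟ π ⟨$⟩ˡ l
  ... | yes refl = begin
    lookup (permute π (flipAt l z)) p            ≡⟨ lookup-permute π (flipAt l z) p ⟩
    lookup (flipAt l z) (π ⟨$⟩ʳ (π ⟨$⟩ˡ l))      ≡⟨ cong (lookup (flipAt l z)) (inverseʳ π) ⟩
    lookup (flipAt l z) l                        ≡⟨ lookup-flipAt l z ⟩
    not (lookup z l)                             ≡⟨ cong (λ q → not (lookup z q)) (inverseʳ π) ⟨
    not (lookup z (π ⟨$⟩ʳ p))                    ≡⟨ cong not (lookup-permute π z p) ⟨
    not (lookup (permute π z) p)                 ≡⟨ lookup-flipAt p (permute π z) ⟨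
    lookup (flipAt p (permute π z)) p            ∎
  ... | no p≢π⁻¹l = begin
    lookup (permute π (flipAt l z)) p            ≡⟨ lookup-permute π (flipAt l z) p ⟩
    lookup (flipAt l z) (π ⟨$⟩ʳ p)               ≡⟨ lookup-flipAt′ πp≢l z ⟩
    lookup z (π ⟨$⟩ʳ p)                          ≡⟨ lookup-permute π z p ⟨
    lookup (permute π z) p                       ≡⟨ lookup-flipAt′ p≢π⁻¹l (permute π z) ⟨
    lookup (flipAt (π ⟨$⟩ˡ l) (permute π z)) p   ∎
    where
    πp≢l : π ⟨$⟩ʳ p ≢ l
    πp≢l eq = p≢π⁻¹l (trans (sym (inverseˡ π)) (cong (π ⟨$⟩ˡ_) eq))

permutationAutomorphism : Permutation′ n → Automorphism n
permutationAutomorphism π = automorphism (permute π) (permute (flip π))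
  (permute-inverse π) (permute-inverse (flip π))
  (flipAt-equivariant⇒adj (permute π) (λ l z → π ⟨$⟩ˡ l , permute-flipAt π l z))
  (flipAt-equivariant⇒adj (permute (flip π)) (λ l z → π ⟨$⟩ʳ l , permute-flipAt (flip π) l z))

transpose-cases : ∀ (i j k : Fin n) →
  (k ≡ i × PC.transpose i j k ≡ j) ⊎ (k ≡ j × PC.transpose i j k ≡ i) ⊎
  (k ≢ i × k ≢ j × PC.transpose i j k ≡ k)
transpose-cases i j k with k ≟ i
... | yes k≡i = inj₁ (k≡i , refl)
... | no k≢i with k ≟ j
...   | yes k≡j = inj₂ (inj₁ (k≡j , refl))
...   | no k≢j  = inj₂ (inj₂ (k≢i , k≢j , refl))

transpose-matchʳ : ∀ (i j : Fin n) → PC.transpose i j j ≡ i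
transpose-matchʳ i j with transpose-cases i j j
... | inj₁ (refl , t≡) = t≡
... | inj₂ (inj₁ (_ , t≡)) = t≡
... | inj₂ (inj₂ (_ , j≢j , _)) = ⊥-elim (j≢j refl)

permute-transpose-≡ : ∀ {i j : Fin n} {z} → lookup z i ≡ lookup z j → permute (transpose i j) z ≡ z
permute-transpose-≡ {i = i} {j} {z} zi≡zj = lookup-ext λ k →
  trans (lookup-permute (transpose i j) z k) (at k)
  where
  at : ∀ k → lookup z (PC.transpose i j k) ≡ lookup z k
  at k with transpose-cases i j k
  ... | inj₁ (refl , t≡)            = trans (cong (lookup z) t≡) (sym zi≡zj)
  ... | inj₂ (inj₁ (refl , t≡))     = trans (cong (lookup z) t≡) zi≡zj
  ... | inj₂ (inj₂ (_ , _ , t≡))    = cong (lookup z) t≡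

permute-transpose-≢ : ∀ {i j : Fin n} {z} → lookup z i ≢ lookup z j →
                      permute (transpose i j) z ≡ flipAt i (flipAt j z)
permute-transpose-≢ {i = i} {j} {z} zi≢zj = lookup-ext λ k →
  trans (lookup-permute (transpose i j) z k) (at k)
  where
  i≢j : i ≢ j
  i≢j refl = zi≢zj refl
  at : ∀ k → lookup z (PC.transpose i j k) ≡ lookup (flipAt i (flipAt j z)) k
  at k with transpose-cases i j k
  ... | inj₁ (refl , t≡) = begin
    lookup z (PC.transpose i j i)       ≡⟨ cong (lookup z) t≡ ⟩
    lookup z j                          ≡⟨ ¬-not (≢-sym zi≢zj) ⟩
    not (lookup z i)                    ≡⟨ cong not (lookup-flipAt′ i≢j z) ⟨
    not (lookup (flipAt j z) i)         ≡⟨ lookup-flipAt i (flipAt j z) ⟨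
    lookup (flipAt i (flipAt j z)) i    ∎
    where open ≡-Reasoning
  ... | inj₂ (inj₁ (refl , t≡)) = begin
    lookup z (PC.transpose i j j)       ≡⟨ cong (lookup z) t≡ ⟩
    lookup z i                          ≡⟨ ¬-not zi≢zj ⟩
    not (lookup z j)                    ≡⟨ lookup-flipAt j z ⟨
    lookup (flipAt j z) j               ≡⟨ lookup-flipAt′ (≢-sym i≢j) (flipAt j z) ⟨
    lookup (flipAt i (flipAt j z)) j    ∎
    where open ≡-Reasoning
  ... | inj₂ (inj₂ (k≢i , k≢j , t≡)) = begin
    lookup z (PC.transpose i j k)       ≡⟨ cong (lookup z) t≡ ⟩
    lookup z k                          ≡⟨ lookup-flipAt′ k≢j z ⟨
    lookup (flipAt j z) k               ≡⟨ lookup-flipAt′ k≢i (flipAt j z) ⟨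
    lookup (flipAt i (flipAt j z)) k    ∎
    where open ≡-Reasoning

-- Extending and restricting automorphisms

onPrefix : ∀ {m} k → (Vertex m → Vertex m) → Vertex (m + k) → Vertex (m + k)
onPrefix {m} k h x = h (take m x) ++ drop m x

onPrefix-inverse : ∀ {m} k (h h′ : Vertex m → Vertex m) → (∀ a → h (h′ a) ≡ a) →
                   ∀ x → onPrefix k h (onPrefix k h′ x) ≡ x
onPrefix-inverse {m} k h h′ inv x = begin
  h (take m (h′ (take m x) ++ drop m x)) ++ drop m (h′ (take m x) ++ drop m x)
    ≡⟨ cong₂ (λ a b → h a ++ b) (take-++ (h′ (take m x)) (drop m x)) (drop-++ (h′ (take m x)) (drop m x)) ⟩
  h (h′ (take m x)) ++ drop m x   ≡⟨ cong (_++ drop m x) (inv (take m x)) ⟩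
  take m x ++ drop m x            ≡⟨ take++drop≡id m x ⟩
  x                               ∎
  where open ≡-Reasoning

onPrefix-adj : ∀ {m} k (h : Vertex m → Vertex m) → (∀ a b → Adj a b → Adj (h a) (h b)) →
               ∀ x y → Adj x y → Adj (onPrefix k h x) (onPrefix k h y)
onPrefix-adj {m} k h h-adj x y adj =
  adj-++⁺ (Sum.map (Prod.map₁ (h-adj _ _)) (Prod.map₁ (cong h))
                   (adj-++⁻ (subst₂ Adj (sym (take++drop≡id m x)) (sym (take++drop≡id m y)) adj)))

extend : ∀ k → Automorphism m → Automorphism (m + k)
extend k φ = automorphism (onPrefix k to) (onPrefix k from)
  (onPrefix-inverse k to from to-from) (onPrefix-inverse k from to from-to)
  (onPrefix-adj k to adj-to) (onPrefix-adj k from (from-adj φ))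
  where open Automorphism φ

conjugate : (e : Vertex m → Vertex n) (r : Vertex n → Vertex m) → (∀ x → r (e x) ≡ x) → (∀ y → e (r y) ≡ y) →
            (∀ x x′ → dist (e x) (e x′) ≡ dist x x′) → Automorphism m → Automorphism n
conjugate e r r∘e e∘r e-isometry φ = automorphism (e ∘′ to ∘′ r) (e ∘′ from ∘′ r)
  (λ y → trans (cong (e ∘′ to) (r∘e _)) (trans (cong e (to-from _)) (e∘r y)))
  (λ y → trans (cong (e ∘′ from) (r∘e _)) (trans (cong e (from-to _)) (e∘r y)))
  (λ y y′ adj → trans (e-isometry _ _) (adj-to _ _ (r-adj y y′ adj)))
  (λ y y′ adj → trans (e-isometry _ _) (from-adj φ _ _ (r-adj y y′ adj)))
  where
  open Automorphism φ
  r-adj : ∀ y y′ → Adj y y′ → Adj (r y) (r y′)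
  r-adj y y′ adj = trans (sym (e-isometry (r y) (r y′))) (trans (cong₂ dist (e∘r y) (e∘r y′)) adj)

Commutes : Fin n → Automorphism n → Set
Commutes d ψ = ∀ x → Automorphism.to ψ (flipAt d x) ≡ flipAt d (Automorphism.to ψ x)

inverse-commutes : ∀ {d : Fin n} ψ → Commutes d ψ → Commutes d (inverse ψ)
inverse-commutes {d = d} ψ comm z = begin
  from (flipAt d z)              ≡⟨ cong (λ q → from (flipAt d q)) (to-from z) ⟨
  from (flipAt d (to (from z)))  ≡⟨ cong from (comm (from z)) ⟨
  from (to (flipAt d (from z)))  ≡⟨ from-to _ ⟩
  flipAt d (from z)              ∎
  where
  open Automorphism ψ
  open ≡-Reasoning

module _ {m k : ℕ} where

  quotient : Automorphism (m + suc k) → Vertex (m + k) → Vertex (m + k)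
  quotient ψ v = removeMid m (Automorphism.to ψ (insertMid m false v))

  module _ (ψ : Automorphism (m + suc k)) (comm : Commutes (m ↑ʳ zero) ψ) where
    open Automorphism ψ

    removeMid-to : ∀ w → removeMid m (to w) ≡ quotient ψ (removeMid m w)
    removeMid-to w with insertMid-removeMid m false w
    ... | inj₁ eq = cong (removeMid m ∘′ to) (sym eq)
    ... | inj₂ eq = begin
      removeMid m (to w)                           ≡⟨ removeMid-flipAt m (to w) ⟨
      removeMid m (flipAt (m ↑ʳ zero) (to w))      ≡⟨ cong (removeMid m) (comm w) ⟨
      removeMid m (to (flipAt (m ↑ʳ zero) w))      ≡⟨ cong (removeMid m ∘′ to) eq ⟨
      quotient ψ (removeMid m w)                   ∎
      where open ≡-Reasoning

    quotient-adj : ∀ v v′ → Adj v v′ → Adj (quotient ψ v) (quotient ψ v′)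
    quotient-adj v v′ adj
      with adj-removeMid m (adj-to _ _ (trans (dist-insertMid m false v v′) adj))
    ... | inj₁ adj′ = adj′
    ... | inj₂ eq = ⊥-elim (insertMid≢flipAt m (to-injective ψ (trans eq (sym (comm (insertMid m false v))))))

    quotient-inverse : ∀ v → quotient ψ (quotient (inverse ψ) v) ≡ v
    quotient-inverse v = begin
      quotient ψ (removeMid m (from (insertMid m false v)))   ≡⟨ removeMid-to _ ⟨
      removeMid m (to (from (insertMid m false v)))           ≡⟨ cong (removeMid m) (to-from _) ⟩
      removeMid m (insertMid m false v)                       ≡⟨ removeMid-insertMid m false v ⟩
      v                                                       ∎
      where open ≡-Reasoning

  descend : (ψ : Automorphism (m + suc k)) → Commutes (m ↑ʳ zero) ψ → Automorphism (m + k)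
  descend ψ comm = automorphism (quotient ψ) (quotient (inverse ψ))
    (quotient-inverse ψ comm) (quotient-inverse (inverse ψ) comm⁻¹)
    (quotient-adj ψ comm) (quotient-adj (inverse ψ) comm⁻¹)
    where comm⁻¹ = inverse-commutes ψ comm

-- Isomorphic functions

module _ {c ℓ : Level} (G : AbelianGroup c ℓ) where
  open AbelianGroup G using (setoid; group; _≈_; ⁻¹-cong)
    renaming (Carrier to V; trans to ≈-trans; sym to ≈-sym; reflexive to ≈-reflexive)
  open import Algebra.Properties.Group group using (⁻¹-injective)
  open import Relation.Binary.Reasoning.Setoid setoid

  signed-cong : ∀ ε {a b} → a ≈ b → signed G ε a ≈ signed G ε b
  signed-cong true  a≈b = a≈b
  signed-cong false a≈b = ⁻¹-cong a≈b

  signed-injective : ∀ ε {a b} → signed G ε a ≈ signed G ε b → a ≈ b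
  signed-injective true  eq = eq
  signed-injective false eq = ⁻¹-injective eq

  Invariant : Fin n → (Vertex n → V) → Set ℓ
  Invariant d F = ∀ x → F (flipAt d x) ≈ F x

  Isomorphic-resp : ∀ {F₁ F₁′ F₂ F₂′ : Vertex n → V} → (∀ x → F₁ x ≡ F₁′ x) → (∀ x → F₂ x ≡ F₂′ x) →
                    Isomorphic G n F₁ F₂ → Isomorphic G n F₁′ F₂′
  Isomorphic-resp F₁≗ F₂≗ (ψ , ε , h) =
    ψ , ε , λ x → ≈-trans (≈-reflexive (sym (F₁≗ x))) (≈-trans (h x) (signed-cong ε (≈-reflexive (F₂≗ _))))

  invariant-transfer : ∀ {F₁ F₂ : Vertex n → V} ((ψ , ε , _) : Isomorphic G n F₁ F₂) {d j} →
    (∀ x → Automorphism.to ψ (flipAt d x) ≡ flipAt j (Automorphism.to ψ x)) → Invariant d F₁ → Invariant j F₂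
  invariant-transfer {F₁ = F₁} {F₂} (ψ , ε , h) {d} {j} dir inv₁ z = begin
    F₂ (flipAt j z)                 ≡⟨ cong (F₂ ∘′ flipAt j) (to-from z) ⟨
    F₂ (flipAt j (to (from z)))     ≈⟨ signed-injective ε (begin
      signed G ε (F₂ (flipAt j (to (from z))))  ≡⟨ cong (signed G ε ∘′ F₂) (dir (from z)) ⟨
      signed G ε (F₂ (to (flipAt d (from z))))  ≈⟨ h _ ⟨
      F₁ (flipAt d (from z))                    ≈⟨ inv₁ (from z) ⟩
      F₁ (from z)                               ≈⟨ h (from z) ⟩
      signed G ε (F₂ (to (from z)))             ∎) ⟩
    F₂ (to (from z))                ≡⟨ cong F₂ (to-from z) ⟩
    F₂ z                            ∎
    where open Automorphism ψ

  invariant-transpose : ∀ {F : Vertex n → V} {i j} → Invariant i F → Invariant j F →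
                        ∀ z → F (permute (transpose i j) z) ≈ F z
  invariant-transpose {F = F} {i} {j} invᵢ invⱼ z with lookup z i ≟ᵇ lookup z j
  ... | yes eq = ≈-reflexive (cong F (permute-transpose-≡ eq))
  ... | no neq = ≈-trans (≈-reflexive (cong F (permute-transpose-≢ neq))) (≈-trans (invᵢ _) (invⱼ z))

  IsomorphicFixing : Fin n → (Vertex n → V) → (Vertex n → V) → Set ℓ
  IsomorphicFixing d F₁ F₂ = Σ (Isomorphic G _ F₁ F₂) λ iso → Commutes d (proj₁ iso)

  align : ∀ (d : Fin n) {F₁ F₂} → Invariant d F₁ → Invariant d F₂ → Isomorphic G n F₁ F₂ →
          IsomorphicFixing d F₁ F₂
  align d {F₁} {F₂} inv₁ inv₂ iso@(ψ , ε , h) = (τ ∘ᴬ ψ , ε , h′) , commutes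
    where
    open Automorphism ψ
    j = proj₁ (direction ψ d)
    dir = proj₂ (direction ψ d)
    π = transpose j d
    τ = permutationAutomorphism π
    h′ : ∀ x → F₁ x ≈ signed G ε (F₂ (permute π (to x)))
    h′ x = ≈-trans (h x) (signed-cong ε (≈-sym (invariant-transpose (invariant-transfer iso dir inv₁) inv₂ (to x))))
    commutes : Commutes d (τ ∘ᴬ ψ)
    commutes x = trans (cong (permute π) (dir x))
      (trans (permute-flipAt π j (to x)) (cong (λ q → flipAt q (permute π (to x))) (transpose-matchʳ d j)))

  invariant-insertMid-removeMid : ∀ m {k} {F : Vertex (m + suc k) → V} → Invariant (m ↑ʳ zero) F →
                                  ∀ w → F w ≈ F (insertMid m false (removeMid m w))
  invariant-insertMid-removeMid m {F = F} inv w with insertMid-removeMid m false w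
  ... | inj₁ eq = ≈-reflexive (cong F (sym eq))
  ... | inj₂ eq = ≈-trans (≈-sym (inv w)) (≈-reflexive (cong F (sym eq)))

  restrictMid : ∀ m {k} {F₁ F₂ : Vertex (m + suc k) → V} → Invariant (m ↑ʳ zero) F₂ →
                IsomorphicFixing (m ↑ʳ zero) F₁ F₂ →
                Isomorphic G (m + k) (F₁ ∘′ insertMid m false) (F₂ ∘′ insertMid m false)
  restrictMid m inv₂ ((ψ , ε , h) , comm) =
    descend ψ comm , ε , λ v → ≈-trans (h _) (signed-cong ε (invariant-insertMid-removeMid m inv₂ _))

  lift-invariant : ∀ m {k} (f : Vertex m → V) → Invariant (m ↑ʳ zero) (lift G m (suc k) f)
  lift-invariant m f w = ≈-reflexive (cong f (take-flipAt-mid m w))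

  lift-up : ∀ m k (f g : Vertex m → V) → Isomorphic G m f g →
            Isomorphic G (m + k) (lift G m k f) (lift G m k g)
  lift-up m k f g (φ , ε , h) = extend k φ , ε , λ x →
    ≈-trans (h (take m x)) (signed-cong ε (≈-reflexive (cong g (sym (take-++ _ (drop m x))))))

  lift-down : ∀ m k (f g : Vertex m → V) → Isomorphic G (m + k) (lift G m k f) (lift G m k g) →
              Isomorphic G m f g
  -- m + 0 is not definitionally m, hence the conjugation by take m.
  lift-down m zero f g (ψ , ε , h) =
    conjugate (take m) (_++ []) (take++[] m) (λ y → take-++ y []) (dist-take m) ψ , ε ,
    λ y → ≈-trans (≈-reflexive (cong f (sym (take-++ y [])))) (h (y ++ []))
  lift-down m (suc k) f g iso = lift-down m k f g
    (Isomorphic-resp (λ v → cong f (take-insertMid m false v)) (λ v → cong g (take-insertMid m false v))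
      (restrictMid m (lift-invariant m g) (align (m ↑ʳ zero) (lift-invariant m f) (lift-invariant m g) iso)))

lemma2 : {c ℓ : Level} (G : AbelianGroup c ℓ) (m k : ℕ)
         (f g : Vertex m → AbelianGroup.Carrier G) →
         Isomorphic G m f g ⇔ Isomorphic G (m + k) (lift G m k f) (lift G m k g)
lemma2 G m k f g = mk⇔ (lift-up G m k f g) (lift-down G m k f g)
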